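{- Let $n\in\mathbb{N}$. The subshift of finite type generated by prohibiting the strings in $\{w\in\{0,1\}^n:\xi(w)\neq 1\}$ is empty; that is, there is no infinite sequence $u\in\{0,1\}^{\mathbb{N}}$ such that $\xi(u_{[i,i+n)})=1$ for all $i\in\mathbb{N}$.
   Context: For a sequence $u=u_0u_1\dots$, $u_{[a,b)}=u_a\dots u_{b-1}$. For a finite string $w$, $\#w$ is its length, $\varepsilon$ the empty string; for $\#w\ge1$, $l(w)$ is $w$ without its last letter and $r(w)$ is $w$ without its first letter. $T^n$ is the alternating string of length $n$ starting with $0$ ($T^0=\varepsilon$, $T^n=T^{n-1}0$ for odd $n$, $T^n=T^{n-1}1$ for even $n\ge2$) and $CT^n$ its letterwise complement. $\xi$: $\xi(\varepsilon)=0$; $\xi(w)=1$ if $w=T^k$, $k\ge2$ even; $\xi(w)=-1$ if $w=CT^k$, $k\ge2$ even; otherwise $\xi(w)=\operatorname{sgn}(\xi(l(w))+\xi(r(w)))$. The subshift of finite type generated by prohibiting a set $F$ of words is the set of (one-sided) sequences in $\{0,1\}^{\mathbb{N}}$ none of whose finite factors lies in $F$. -}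

module Defs where

open import Data.Bool using (Bool; true; false; not; if_then_else_)
open import Data.Nat using (ℕ; zero; suc; _+_)
open import Data.Integer using (ℤ; +_; -[1+_]) renaming (_+_ to _+ℤ_)
open import Data.Vec using (Vec; []; _∷_; _∷ʳ_; init; tail; map; tabulate)
open import Data.Vec.Properties using (≡-dec)
open import Data.Fin using (Fin; toℕ)
import Data.Bool.Properties as BP
open import Relation.Nullary using (yes; no)

-- Letters: 0 = false, 1 = true.  A string of length n is a Vec Bool n.

evenB : ℕ → Bool
evenB zero = true
evenB (suc zero) = false
evenB (suc (suc n)) = evenB n

T : (n : ℕ) → Vec Bool n
T zero = []
T (suc n) = T n ∷ʳ (if evenB (suc n) then true else false)

CT : (n : ℕ) → Vec Bool n
CT n = map not (T n)

sgn : ℤ → ℤ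
sgn (+ zero) = + 0
sgn (+ suc _) = + 1
sgn -[1+ _ ] = -[1+ 0 ]

-- ξ, by recursion on the length; l = init, r = tail
ξ : (n : ℕ) → Vec Bool n → ℤ
ξ zero [] = + 0
ξ (suc n) w with evenB (suc n)
... | false = sgn (ξ n (init w) +ℤ ξ n (tail w))
... | true with ≡-dec BP._≟_ w (T (suc n)) | ≡-dec BP._≟_ w (CT (suc n))
...   | yes _ | _ = + 1
...   | no _ | yes _ = -[1+ 0 ]
...   | no _ | no _ = sgn (ξ n (init w) +ℤ ξ n (tail w))

factor : (ℕ → Bool) → (i n : ℕ) → Vec Bool n
factor u i n = tabulate (λ (j : Fin n) → u (i + toℕ j))

-- Every alternating word of even length is T, with ξ = 1, or CT, with ξ = -1; every other
-- word w has ξ(w) = sgn(ξ(l w) + ξ(r w)), and ξ(CTᵏ) = -ξ(Tᵏ) ≤ 0.  Suppose all length-n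
-- windows of u have ξ = 1.  Then every window contains an ascent 01, and the window starting
-- at the 1 of such an ascent is neither Tⁿ nor CTⁿ, so it contains a plateau 00 or 11.
-- Following a plateau 11 to the next 0, or a plateau 00 back to the previous 1, yields a
-- factor 1b0 arbitrarily far out; its ξ is -1.  A non-alternating window with ξ = -1 next to
-- a window with ξ ≤ 0 survives lengthening both by one letter (the pair moves at most one step
-- left), since sgn(-1 + y) = -1 for y ≤ 0.  Growing it from length 3 to length n produces a
-- length-n window with ξ = -1.

module Submission where

open import Defs
open import Data.Bool using (Bool; true; false; not; if_then_else_)
open import Data.Bool.Properties using (not-involutive) renaming (_≟_ to _≟ᵇ_)
open import Data.Nat using (ℕ; zero; suc; _+_; _∸_; _≤_; _<_; s≤s)
open import Data.Nat.Properties
  using ( ≤-refl; ≤-reflexive; ≤-trans; n≤1+n; m≤n⇒m≤1+n; m≤m+n; m≤n+m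
        ; ≤∧≢⇒<; <⇒≱; +-comm; +-suc; +-identityʳ; m∸n+n≡m)
open import Data.Integer using (ℤ; +_; -[1+_]; -_) renaming (_+_ to _+ℤ_)
open import Data.Integer.Properties using (+-inverseˡ; +-inverseʳ; neg-involutive)
open import Data.Vec using (Vec; []; _∷_; _∷ʳ_; head; init; tail; map)
open import Data.Vec.Properties
  using ( ≡-dec; init-∷ʳ; map-∷ʳ; map-∘; map-cong; map-id; tabulate-cong
        ; ∷-injective; ∷-injectiveˡ)
open import Data.Fin using (toℕ)
open import Data.Product using (Σ; _×_; _,_; proj₁; proj₂)
open import Data.Sum using (_⊎_; inj₁; inj₂)
open import Relation.Nullary using (¬_; Dec; yes; no; contradiction)
open import Relation.Binary.PropositionalEquality
open ≡-Reasoning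

private
  variable
    m : ℕ

T-letter : ℕ → Bool
T-letter k = if evenB k then true else false

T-letter-suc : ∀ m → T-letter (suc (suc m)) ≡ not (T-letter (suc m))
T-letter-suc zero = refl
T-letter-suc (suc zero) = refl
T-letter-suc (suc (suc m)) = T-letter-suc m

map-not-involutive : (w : Vec Bool m) → map not (map not w) ≡ w
map-not-involutive w =
  trans (sym (map-∘ not not w)) (trans (map-cong not-involutive w) (map-id w))

T-∷ : ∀ m → T (suc m) ≡ false ∷ CT m
T-∷ zero = refl
T-∷ (suc m) = begin
  T (suc m) ∷ʳ T-letter (suc (suc m))
    ≡⟨ cong (_∷ʳ T-letter (suc (suc m))) (T-∷ m) ⟩
  false ∷ (CT m ∷ʳ T-letter (suc (suc m)))
    ≡⟨ cong (λ b → false ∷ (CT m ∷ʳ b)) (T-letter-suc m) ⟩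
  false ∷ (CT m ∷ʳ not (T-letter (suc m)))
    ≡⟨ cong (false ∷_) (map-∷ʳ not (T-letter (suc m)) (T m)) ⟨
  false ∷ CT (suc m)
    ∎

CT-∷ : ∀ m → CT (suc m) ≡ true ∷ T m
CT-∷ m = trans (cong (map not) (T-∷ m)) (cong (true ∷_) (map-not-involutive (T m)))

T-init : ∀ m → init (T (suc m)) ≡ T m
T-init m = init-∷ʳ (T-letter (suc m)) (T m)

CT-init : ∀ m → init (CT (suc m)) ≡ CT m
CT-init m = trans (cong init (map-∷ʳ not (T-letter (suc m)) (T m))) (init-∷ʳ _ (CT m))

T-tail : ∀ m → tail (T (suc m)) ≡ CT m
T-tail m = cong tail (T-∷ m)

CT-tail : ∀ m → tail (CT (suc m)) ≡ T m
CT-tail m = cong tail (CT-∷ m)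

-- A data type rather than w ≡ T m ⊎ w ≡ CT m: with-abstracting evenB (suc m), as one must to
-- unfold ξ, would otherwise also rewrite the letters of T (suc m) inside the hypothesis.
data Alternating : Vec Bool m → Set where
  T-alternating  : Alternating (T m)
  CT-alternating : Alternating (CT m)

alternating-≡ : {w : Vec Bool m} → Alternating w → w ≡ T m ⊎ w ≡ CT m
alternating-≡ T-alternating = inj₁ refl
alternating-≡ CT-alternating = inj₂ refl

alternating? : (w : Vec Bool m) → Dec (Alternating w)
alternating? {m} w with ≡-dec _≟ᵇ_ w (T m) | ≡-dec _≟ᵇ_ w (CT m)
... | yes refl | _ = yes T-alternating
... | no _ | yes refl = yes CT-alternating
... | no w≢T | no w≢CT = no λ { T-alternating → w≢T refl ; CT-alternating → w≢CT refl }

init-alternating : {w : Vec Bool (suc m)} → Alternating w → Alternating (init w)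
init-alternating {m} T-alternating = subst Alternating (sym (T-init m)) T-alternating
init-alternating {m} CT-alternating = subst Alternating (sym (CT-init m)) CT-alternating

tail-alternating : {w : Vec Bool (suc m)} → Alternating w → Alternating (tail w)
tail-alternating {m} T-alternating = subst Alternating (sym (T-tail m)) CT-alternating
tail-alternating {m} CT-alternating = subst Alternating (sym (CT-tail m)) T-alternating

singleton-alternating : ∀ b → Alternating (b ∷ [])
singleton-alternating false = T-alternating {1}
singleton-alternating true = CT-alternating {1}

∷-alternating : ∀ x y {w : Vec Bool m} → x ≢ y →
                Alternating (y ∷ w) → Alternating (x ∷ y ∷ w)
∷-alternating {m} x y {w} x≢y alt = by-cases x y x≢y (alternating-≡ alt)
  where
  by-cases : ∀ x y → x ≢ y → y ∷ w ≡ T (suc m) ⊎ y ∷ w ≡ CT (suc m) →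
             Alternating (x ∷ y ∷ w)
  by-cases false false x≢y _ = contradiction refl x≢y
  by-cases true true x≢y _ = contradiction refl x≢y
  by-cases false true _ (inj₁ p) = contradiction (∷-injectiveˡ (trans p (T-∷ m))) λ ()
  by-cases false true _ (inj₂ q) =
    subst Alternating (sym (trans (cong (false ∷_) q) (sym (T-∷ (suc m))))) T-alternating
  by-cases true false _ (inj₁ p) =
    subst Alternating (sym (trans (cong (true ∷_) p) (sym (CT-∷ (suc m))))) CT-alternating
  by-cases true false _ (inj₂ q) = contradiction (∷-injectiveˡ (trans q (CT-∷ m))) λ ()

data Trit : ℤ → Set where
  trit⁻ : Trit -[1+ 0 ]
  trit⁰ : Trit (+ 0)
  trit⁺ : Trit (+ 1)

sgn-trit : ∀ x → Trit (sgn x)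
sgn-trit (+ zero) = trit⁰
sgn-trit (+ suc _) = trit⁺
sgn-trit -[1+ _ ] = trit⁻

sgn[x+y]≡1⇒x≡1⊎y≡1 : ∀ {x y} → Trit x → Trit y →
                      sgn (x +ℤ y) ≡ + 1 → x ≡ + 1 ⊎ y ≡ + 1
sgn[x+y]≡1⇒x≡1⊎y≡1 trit⁺ _ _ = inj₁ refl
sgn[x+y]≡1⇒x≡1⊎y≡1 _ trit⁺ _ = inj₂ refl
sgn[x+y]≡1⇒x≡1⊎y≡1 trit⁻ trit⁻ ()
sgn[x+y]≡1⇒x≡1⊎y≡1 trit⁻ trit⁰ ()
sgn[x+y]≡1⇒x≡1⊎y≡1 trit⁰ trit⁻ ()
sgn[x+y]≡1⇒x≡1⊎y≡1 trit⁰ trit⁰ ()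

sgn[x-1]≡-1 : ∀ {x} → Trit x → x ≢ + 1 → sgn (x +ℤ -[1+ 0 ]) ≡ -[1+ 0 ]
sgn[x-1]≡-1 trit⁻ _ = refl
sgn[x-1]≡-1 trit⁰ _ = refl
sgn[x-1]≡-1 trit⁺ x≢1 = contradiction refl x≢1

sgn[-1+y]≡-1 : ∀ {y} → Trit y → y ≢ + 1 → sgn (-[1+ 0 ] +ℤ y) ≡ -[1+ 0 ]
sgn[-1+y]≡-1 trit⁻ _ = refl
sgn[-1+y]≡-1 trit⁰ _ = refl
sgn[-1+y]≡-1 trit⁺ y≢1 = contradiction refl y≢1

sgn[x-1]≢1 : ∀ {x} → Trit x → sgn (x +ℤ -[1+ 0 ]) ≢ + 1
sgn[x-1]≢1 trit⁻ ()
sgn[x-1]≢1 trit⁰ ()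
sgn[x-1]≢1 trit⁺ ()

sgn[-1+y]≢1 : ∀ {y} → Trit y → sgn (-[1+ 0 ] +ℤ y) ≢ + 1
sgn[-1+y]≢1 trit⁻ ()
sgn[-1+y]≢1 trit⁰ ()
sgn[-1+y]≢1 trit⁺ ()

ξ-trit : (w : Vec Bool m) → Trit (ξ m w)
ξ-trit {zero} [] = trit⁰
ξ-trit {suc m} w with evenB (suc m)
... | false = sgn-trit _
... | true with ≡-dec _≟ᵇ_ w (T (suc m)) | ≡-dec _≟ᵇ_ w (CT (suc m))
...   | yes _ | _ = trit⁺
...   | no _ | yes _ = trit⁻
...   | no _ | no _ = sgn-trit _

ξ-unfold : (w : Vec Bool (suc m)) → ¬ Alternating w →
           ξ (suc m) w ≡ sgn (ξ m (init w) +ℤ ξ m (tail w))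
ξ-unfold {m} w ¬alt with evenB (suc m)
... | false = refl
... | true with ≡-dec _≟ᵇ_ w (T (suc m)) | ≡-dec _≟ᵇ_ w (CT (suc m))
...   | yes refl | _ = contradiction T-alternating ¬alt
...   | no _ | yes refl = contradiction CT-alternating ¬alt
...   | no _ | no _ = refl

ξ-odd : ∀ m (w : Vec Bool (suc m)) → evenB (suc m) ≡ false →
        ξ (suc m) w ≡ sgn (ξ m (init w) +ℤ ξ m (tail w))
ξ-odd m w odd with evenB (suc m) | odd
... | false | refl = refl

ξ-even : ∀ m {w : Vec Bool (suc m)} → evenB (suc m) ≡ true → Alternating w →
         ξ (suc m) w ≡ (if head w then -[1+ 0 ] else + 1)
ξ-even m {w} even alt with evenB (suc m) | even
... | true | refl with ≡-dec _≟ᵇ_ w (T (suc m)) | ≡-dec _≟ᵇ_ w (CT (suc m))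
...   | yes w≡T | _ = cong (λ v → if head v then -[1+ 0 ] else + 1) (sym (trans w≡T (T-∷ m)))
...   | no _ | yes w≡CT = cong (λ v → if head v then -[1+ 0 ] else + 1) (sym (trans w≡CT (CT-∷ m)))
...   | no w≢T | no w≢CT with alternating-≡ alt
...     | inj₁ w≡T = contradiction w≡T w≢T
...     | inj₂ w≡CT = contradiction w≡CT w≢CT

ξ-T-even : ∀ m → evenB (suc m) ≡ true → ξ (suc m) (T (suc m)) ≡ + 1
ξ-T-even m even = trans (ξ-even m even T-alternating)
                        (cong (λ v → if head v then -[1+ 0 ] else + 1) (T-∷ m))

ξ-CT-even : ∀ m → evenB (suc m) ≡ true → ξ (suc m) (CT (suc m)) ≡ -[1+ 0 ]
ξ-CT-even m even = trans (ξ-even m even CT-alternating)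
                         (cong (λ v → if head v then -[1+ 0 ] else + 1) (CT-∷ m))

ξ-odd-alternating : ∀ m → evenB (suc m) ≡ false → ξ m (CT m) ≡ - ξ m (T m) →
                    ξ (suc m) (T (suc m)) ≡ + 0 × ξ (suc m) (CT (suc m)) ≡ + 0
ξ-odd-alternating m odd ξ-CTₘ = T-value , CT-value
  where
  t = ξ m (T m)
  T-value : ξ (suc m) (T (suc m)) ≡ + 0
  T-value = begin
    ξ (suc m) (T (suc m))
      ≡⟨ ξ-odd m (T (suc m)) odd ⟩
    sgn (ξ m (init (T (suc m))) +ℤ ξ m (tail (T (suc m))))
      ≡⟨ cong₂ (λ v w → sgn (ξ m v +ℤ ξ m w)) (T-init m) (T-tail m) ⟩
    sgn (t +ℤ ξ m (CT m))
      ≡⟨ cong (λ x → sgn (t +ℤ x)) ξ-CTₘ ⟩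
    sgn (t +ℤ - t)
      ≡⟨ cong sgn (+-inverseʳ t) ⟩
    + 0
      ∎
  CT-value : ξ (suc m) (CT (suc m)) ≡ + 0
  CT-value = begin
    ξ (suc m) (CT (suc m))
      ≡⟨ ξ-odd m (CT (suc m)) odd ⟩
    sgn (ξ m (init (CT (suc m))) +ℤ ξ m (tail (CT (suc m))))
      ≡⟨ cong₂ (λ v w → sgn (ξ m v +ℤ ξ m w)) (CT-init m) (CT-tail m) ⟩
    sgn (ξ m (CT m) +ℤ t)
      ≡⟨ cong (λ x → sgn (x +ℤ t)) ξ-CTₘ ⟩
    sgn (- t +ℤ t)
      ≡⟨ cong sgn (+-inverseˡ t) ⟩
    + 0
      ∎

ξ-CT : ∀ m → ξ m (CT m) ≡ - ξ m (T m)
ξ-CT zero = refl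
ξ-CT (suc m) = by-parity (evenB (suc m)) refl
  where
  by-parity : ∀ b → evenB (suc m) ≡ b → ξ (suc m) (CT (suc m)) ≡ - ξ (suc m) (T (suc m))
  by-parity true even = trans (ξ-CT-even m even) (cong -_ (sym (ξ-T-even m even)))
  by-parity false odd with ξ-odd-alternating m odd (ξ-CT m)
  ... | T-value , CT-value = trans CT-value (cong -_ (sym T-value))

ξ-T≢-1 : ∀ m → ξ m (T m) ≢ -[1+ 0 ]
ξ-T≢-1 zero ()
ξ-T≢-1 (suc m) = by-parity (evenB (suc m)) refl
  where
  by-parity : ∀ b → evenB (suc m) ≡ b → ξ (suc m) (T (suc m)) ≢ -[1+ 0 ]
  by-parity true even eq = contradiction (trans (sym (ξ-T-even m even)) eq) λ ()
  by-parity false odd eq = contradiction (trans (sym (proj₁ (ξ-odd-alternating m odd (ξ-CT m)))) eq) λ ()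

ξ-CT≢1 : ∀ m → ξ m (CT m) ≢ + 1
ξ-CT≢1 m eq = ξ-T≢-1 m (trans (sym (neg-involutive (ξ m (T m)))) (cong -_ (trans (sym (ξ-CT m)) eq)))

ξ₂≡1⇒ascent : ∀ a b → ξ 2 (a ∷ b ∷ []) ≡ + 1 → a ≡ false × b ≡ true
ξ₂≡1⇒ascent false true _ = refl , refl
ξ₂≡1⇒ascent false false ()
ξ₂≡1⇒ascent true true ()
ξ₂≡1⇒ascent true false ()

ξ₃[1b0]≡-1 : ∀ b → ξ 3 (true ∷ b ∷ false ∷ []) ≡ -[1+ 0 ]
ξ₃[1b0]≡-1 false = refl
ξ₃[1b0]≡-1 true = refl

¬alternating[1b0] : ∀ b → ¬ Alternating (true ∷ b ∷ false ∷ [])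
¬alternating[1b0] _ ()

ξ₃[10c]≢1 : ∀ c → ξ 3 (true ∷ false ∷ c ∷ []) ≢ + 1
ξ₃[10c]≢1 false ()
ξ₃[10c]≢1 true ()

ξ₃[a10]≢1 : ∀ a → ξ 3 (a ∷ true ∷ false ∷ []) ≢ + 1
ξ₃[a10]≢1 false ()
ξ₃[a10]≢1 true ()

factor-tail : ∀ u i m → tail (factor u i (suc m)) ≡ factor u (suc i) m
factor-tail u i m = tabulate-cong (λ j → cong u (+-suc i (toℕ j)))

factor-init : ∀ u i m → init (factor u i (suc m)) ≡ factor u i m
factor-init u i zero = refl
factor-init u i (suc m) = cong (u (i + 0) ∷_) (factor-init (λ k → u (i + suc k)) 0 m)

factor-∷ : ∀ u i m → factor u i (suc m) ≡ u i ∷ factor u (suc i) m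
factor-∷ u i m = cong₂ _∷_ (cong u (+-identityʳ i)) (factor-tail u i m)

factor-∷∷ : ∀ u i m → factor u i (suc (suc m)) ≡ u i ∷ u (suc i) ∷ factor u (suc (suc i)) m
factor-∷∷ u i m = trans (factor-∷ u i (suc m)) (cong (u i ∷_) (factor-∷ u (suc i) m))

module Windows (u : ℕ → Bool) where

  ξ-at : ℕ → ℕ → ℤ
  ξ-at m i = ξ m (factor u i m)

  ξ-at-trit : ∀ m i → Trit (ξ-at m i)
  ξ-at-trit m i = ξ-trit (factor u i m)

  NonAlternating : ℕ → ℕ → Set
  NonAlternating i m = ¬ Alternating (factor u i m)

  nonAlternating-extendʳ : ∀ {i m} → NonAlternating i m → NonAlternating i (suc m)
  nonAlternating-extendʳ {i} {m} ¬alt alt =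
    ¬alt (subst Alternating (factor-init u i m) (init-alternating alt))

  nonAlternating-extendˡ : ∀ {i m} → NonAlternating (suc i) m → NonAlternating i (suc m)
  nonAlternating-extendˡ {i} {m} ¬alt alt =
    ¬alt (subst Alternating (factor-tail u i m) (tail-alternating alt))

  ξ-at-unfold : ∀ {i m} → NonAlternating i (suc m) →
                ξ-at (suc m) i ≡ sgn (ξ-at m i +ℤ ξ-at m (suc i))
  ξ-at-unfold {i} {m} ¬alt =
    trans (ξ-unfold _ ¬alt)
          (cong₂ (λ v w → sgn (ξ m v +ℤ ξ m w)) (factor-init u i m) (factor-tail u i m))

  ascent-of-T : ∀ m i → factor u i (suc m) ≡ T (suc m) → ξ-at (suc m) i ≡ + 1 →
                u i ≡ false × u (suc i) ≡ true
  ascent-of-T zero i w≡T ξ≡1 = contradiction (trans (cong (ξ 1) (sym w≡T)) ξ≡1) λ ()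
  ascent-of-T (suc m) i w≡T _ with ∷-injective (begin
      u i ∷ u (suc i) ∷ factor u (suc (suc i)) m
        ≡⟨ factor-∷∷ u i m ⟨
      factor u i (suc (suc m))  ≡⟨ w≡T ⟩
      T (suc (suc m))           ≡⟨ trans (T-∷ (suc m)) (cong (false ∷_) (CT-∷ m)) ⟩
      false ∷ true ∷ T m        ∎)
  ... | ui≡0 , rest = ui≡0 , ∷-injectiveˡ rest

  ascent-in-window : ∀ m i → ξ-at m i ≡ + 1 →
                     Σ ℕ λ j → i ≤ j × u j ≡ false × u (suc j) ≡ true
  ascent-in-window zero i ()
  ascent-in-window (suc m) i ξ≡1 with alternating? (factor u i (suc m))
  ... | yes alt with alternating-≡ alt
  ...   | inj₁ w≡T = i , ≤-refl , ascent-of-T m i w≡T ξ≡1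
  ...   | inj₂ w≡CT = contradiction (trans (cong (ξ (suc m)) (sym w≡CT)) ξ≡1) (ξ-CT≢1 (suc m))
  ascent-in-window (suc m) i ξ≡1 | no ¬alt
    with sgn[x+y]≡1⇒x≡1⊎y≡1 (ξ-at-trit m i) (ξ-at-trit m (suc i))
           (trans (sym (ξ-at-unfold ¬alt)) ξ≡1)
  ... | inj₁ ξˡ≡1 = ascent-in-window m i ξˡ≡1
  ... | inj₂ ξʳ≡1 with ascent-in-window m (suc i) ξʳ≡1
  ...   | j , i<j , ascent = j , ≤-trans (n≤1+n i) i<j , ascent

  alternating-or-plateau : ∀ m i →
                           Alternating (factor u i m) ⊎ Σ ℕ λ q → i ≤ q × u q ≡ u (suc q)
  alternating-or-plateau zero i = inj₁ T-alternating
  alternating-or-plateau (suc zero) i = inj₁ (singleton-alternating (u (i + 0)))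
  alternating-or-plateau (suc (suc m)) i with u i ≟ᵇ u (suc i) | alternating-or-plateau (suc m) (suc i)
  ... | yes flat | _ = inj₂ (i , ≤-refl , flat)
  ... | no _ | inj₂ (q , i<q , flat) = inj₂ (q , ≤-trans (n≤1+n i) i<q , flat)
  ... | no step | inj₁ alt =
    inj₁ (subst Alternating (sym (factor-∷∷ u i m))
           (∷-alternating (u i) (u (suc i)) step (subst Alternating (factor-∷ u (suc i) m) alt)))

  plateau-after-one : ∀ {n b} → u b ≡ true → ξ-at (suc n) b ≡ + 1 →
                      Σ ℕ λ q → b ≤ q × u q ≡ u (suc q)
  plateau-after-one {n} {b} ub ξ≡1 with alternating-or-plateau (suc n) b
  ... | inj₂ plateau = plateau
  ... | inj₁ alt with alternating-≡ alt
  ...   | inj₁ w≡T =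
    contradiction (trans (sym ub) (∷-injectiveˡ (trans (sym (factor-∷ u b n)) (trans w≡T (T-∷ n)))))
                  λ ()
  ...   | inj₂ w≡CT = contradiction (trans (cong (ξ (suc n)) (sym w≡CT)) ξ≡1) (ξ-CT≢1 (suc n))

  -- the window at p is 1b0, the only shape of length 3 with ξ = -1
  Descent : ℕ → Set
  Descent p = u p ≡ true × u (suc (suc p)) ≡ false

  descent-after-plateau : ∀ d {q} → u q ≡ true → u (suc q) ≡ true →
                          u (d + suc (suc q)) ≡ false →
                          Σ ℕ λ p → q ≤ p × Descent p
  descent-after-plateau zero {q} uq _ uq₂ = q , ≤-refl , uq , uq₂
  descent-after-plateau (suc d) {q} uq uq₁ uc with u (suc (suc q)) in uq₂
  ... | false = q , ≤-refl , uq , uq₂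
  ... | true
      with descent-after-plateau d uq₁ uq₂ (subst (λ k → u k ≡ false) (sym (+-suc d (suc (suc q)))) uc)
  ...   | p , q<p , descent = p , ≤-trans (n≤1+n q) q<p , descent

  descent-before-plateau : ∀ d {b} → u b ≡ true →
                           u (d + suc b) ≡ false → u (suc (d + suc b)) ≡ false →
                           Σ ℕ λ p → b ≤ p × Descent p
  descent-before-plateau zero {b} ub _ ub₂ = b , ≤-refl , ub , ub₂
  descent-before-plateau (suc d) {b} ub uq uq₁ with u (d + suc b) in uq₋₁
  ... | true = d + suc b , ≤-trans (n≤1+n b) (m≤n+m (suc b) d) , uq₋₁ , uq₁
  ... | false = descent-before-plateau d ub uq₋₁ uq

  descent-from-plateau : ∀ {n b q} → (∀ i → ξ-at n i ≡ + 1) →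
                         u b ≡ true → b ≤ q → u q ≡ u (suc q) →
                         Σ ℕ λ p → b ≤ p × Descent p
  descent-from-plateau {n} {b} {q} all≡1 ub b≤q flat with u q in uq
  ... | true with ascent-in-window n (suc (suc q)) (all≡1 _)
  ...   | c , q+2≤c , uc , _
          with descent-after-plateau (c ∸ suc (suc q)) uq (sym flat)
                 (subst (λ k → u k ≡ false) (sym (m∸n+n≡m q+2≤c)) uc)
  ...     | p , q≤p , descent = p , ≤-trans b≤q q≤p , descent
  descent-from-plateau {n} {b} {q} all≡1 ub b≤q flat | false =
    descent-before-plateau (q ∸ suc b) ub
      (subst (λ k → u k ≡ false) (sym q≡) uq)
      (subst (λ k → u (suc k) ≡ false) (sym q≡) (sym flat))
    where
    b<q : b < q
    b<q = ≤∧≢⇒< b≤q (λ b≡q → contradiction (trans (sym ub) (trans (cong u b≡q) uq)) λ ())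
    q≡ : q ∸ suc b + suc b ≡ q
    q≡ = m∸n+n≡m b<q

  descent-beyond : ∀ {n} → (∀ i → ξ-at (suc n) i ≡ + 1) →
                   ∀ N → Σ ℕ λ p → N ≤ p × Descent p
  descent-beyond {n} all≡1 N with ascent-in-window (suc n) N (all≡1 N)
  ... | a , N≤a , _ , ua₁ with plateau-after-one {n} ua₁ (all≡1 (suc a))
  ...   | q , a<q , flat with descent-from-plateau {suc n} all≡1 ua₁ a<q flat
  ...     | p , a<p , descent = p , ≤-trans N≤a (≤-trans (n≤1+n a) a<p) , descent

  Negative : ℕ → ℕ → Set
  Negative m p = ξ-at m p ≡ -[1+ 0 ] × NonAlternating p m

  negative-extendʳ : ∀ {m p} → Negative m p → ξ-at m (suc p) ≢ + 1 → Negative (suc m) p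
  negative-extendʳ {m} {p} (neg , ¬alt) y≢1 = value , nonAlternating-extendʳ ¬alt
    where
    value : ξ-at (suc m) p ≡ -[1+ 0 ]
    value = begin
      ξ-at (suc m) p                     ≡⟨ ξ-at-unfold (nonAlternating-extendʳ ¬alt) ⟩
      sgn (ξ-at m p +ℤ ξ-at m (suc p))   ≡⟨ cong (λ x → sgn (x +ℤ ξ-at m (suc p))) neg ⟩
      sgn (-[1+ 0 ] +ℤ ξ-at m (suc p))   ≡⟨ sgn[-1+y]≡-1 (ξ-at-trit m (suc p)) y≢1 ⟩
      -[1+ 0 ]                           ∎

  negative-extendˡ : ∀ {m p} → ξ-at m p ≢ + 1 → Negative m (suc p) → Negative (suc m) p
  negative-extendˡ {m} {p} x≢1 (neg , ¬alt) = value , nonAlternating-extendˡ ¬alt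
    where
    value : ξ-at (suc m) p ≡ -[1+ 0 ]
    value = begin
      ξ-at (suc m) p                     ≡⟨ ξ-at-unfold (nonAlternating-extendˡ ¬alt) ⟩
      sgn (ξ-at m p +ℤ ξ-at m (suc p))   ≡⟨ cong (λ y → sgn (ξ-at m p +ℤ y)) neg ⟩
      sgn (ξ-at m p +ℤ -[1+ 0 ])         ≡⟨ sgn[x-1]≡-1 (ξ-at-trit m p) x≢1 ⟩
      -[1+ 0 ]                           ∎

  nonpositive-extendʳ : ∀ {m p} → Negative m p → ξ-at (suc m) p ≢ + 1
  nonpositive-extendʳ {m} {p} (neg , ¬alt) =
    subst (_≢ + 1)
      (sym (trans (ξ-at-unfold (nonAlternating-extendʳ ¬alt))
                  (cong (λ x → sgn (x +ℤ ξ-at m (suc p))) neg)))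
      (sgn[-1+y]≢1 (ξ-at-trit m (suc p)))

  nonpositive-extendˡ : ∀ {m p} → Negative m (suc p) → ξ-at (suc m) p ≢ + 1
  nonpositive-extendˡ {m} {p} (neg , ¬alt) =
    subst (_≢ + 1)
      (sym (trans (ξ-at-unfold (nonAlternating-extendˡ ¬alt))
                  (cong (λ y → sgn (ξ-at m p +ℤ y)) neg)))
      (sgn[x-1]≢1 (ξ-at-trit m p))

  -- The bound n ≤ p + m leaves room for the pair to move one step left per step of growth.
  data NegativePair (n m : ℕ) : Set where
    left-neighbour  : ∀ p → n ≤ p + m → ξ-at m p ≢ + 1 → Negative m (suc p) → NegativePair n m
    right-neighbour : ∀ p → n ≤ p + m → Negative m p → ξ-at m (suc p) ≢ + 1 → NegativePair n m

  grow : ∀ {n m} → m < n → NegativePair n m → NegativePair n (suc m)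
  grow {n} {m} _ (left-neighbour p bound x≢1 neg) =
    right-neighbour p (subst (n ≤_) (sym (+-suc p m)) (m≤n⇒m≤1+n bound))
      (negative-extendˡ x≢1 neg) (nonpositive-extendʳ neg)
  grow m<n (right-neighbour zero bound _ _) = contradiction bound (<⇒≱ m<n)
  grow {n} {m} _ (right-neighbour (suc p) bound neg y≢1) =
    left-neighbour p (subst (n ≤_) (sym (+-suc p m)) bound)
      (nonpositive-extendˡ neg) (negative-extendʳ neg y≢1)

  grow-by : ∀ {n m} d → d + m ≤ n → NegativePair n m → NegativePair n (d + m)
  grow-by zero _ pair = pair
  grow-by (suc d) le pair = grow le (grow-by d (≤-trans (n≤1+n _) le) pair)

  no-negative-pair : ∀ {n} → (∀ i → ξ-at n i ≡ + 1) → ¬ NegativePair n n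
  no-negative-pair all≡1 (left-neighbour p _ _ (neg , _)) =
    contradiction (trans (sym neg) (all≡1 (suc p))) λ ()
  no-negative-pair all≡1 (right-neighbour p _ (neg , _) _) =
    contradiction (trans (sym neg) (all≡1 p)) λ ()

  window₃ : ∀ {p a b c} → u p ≡ a → u (suc p) ≡ b → u (suc (suc p)) ≡ c →
            factor u p 3 ≡ a ∷ b ∷ c ∷ []
  window₃ {p} refl refl refl =
    trans (factor-∷∷ u p 1) (cong (λ w → u p ∷ u (suc p) ∷ w) (factor-∷ u (suc (suc p)) 0))

  descent-negative : ∀ {p} → Descent p → Negative 3 p
  descent-negative {p} (up , up₂) =
    trans (cong (ξ 3) word) (ξ₃[1b0]≡-1 (u (suc p))) ,
    λ alt → ¬alternating[1b0] (u (suc p)) (subst Alternating word alt)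
    where word = window₃ up refl up₂

  pair-from-descent : ∀ {n p} → n < p → Descent p → NegativePair n 3
  pair-from-descent {n} {suc p} (s≤s n≤p) descent@(up , up₂) with u (suc (suc p)) in up₁
  ... | true = right-neighbour (suc p) (≤-trans n≤p (≤-trans (n≤1+n p) (m≤m+n (suc p) 3)))
                 (descent-negative descent)
                 (subst (_≢ + 1) (cong (ξ 3) (sym (window₃ up₁ up₂ refl)))
                   (ξ₃[10c]≢1 (u (suc (suc (suc (suc p)))))))
  ... | false = left-neighbour p (≤-trans n≤p (m≤m+n p 3))
                  (subst (_≢ + 1) (cong (ξ 3) (sym (window₃ refl up up₁))) (ξ₃[a10]≢1 (u p)))
                  (descent-negative descent)

corollary2p18 : (n : ℕ) →
    ¬ (Σ (ℕ → Bool) (λ u → (i : ℕ) → ξ n (factor u i n) ≡ + 1))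
corollary2p18 zero (u , all≡1) = contradiction (all≡1 0) λ ()
corollary2p18 (suc zero) (u , all≡1) = contradiction (all≡1 0) λ ()
corollary2p18 (suc (suc zero)) (u , all≡1) =
  contradiction (trans (sym (proj₂ (ξ₂≡1⇒ascent (u 0) (u 1) (all≡1 0))))
                       (proj₁ (ξ₂≡1⇒ascent (u 1) (u 2) (all≡1 1)))) λ ()
corollary2p18 n@(suc (suc (suc d))) (u , all≡1) =
  let open Windows u
      _ , n<p , descent = descent-beyond {suc (suc d)} all≡1 (suc n)
      pairₙ = grow-by d (≤-reflexive (+-comm d 3)) (pair-from-descent n<p descent)
  in no-negative-pair all≡1 (subst (NegativePair n) (+-comm d 3) pairₙ)
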